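{- For integers $c\ge1$ and $k\ge1$, let $\Delta(k,c)$ be the set of $(b_0,\dots,b_{k-1})$ with nonnegative entries summing to $c$. For an integer point $B=(b_0,\dots,b_{k-1})\in\Delta(k,c)$ define \[wt_{q,0}(B)=(q-1)^{\#\{i: b_i>0\}-1}\prod_i wt_{q,0}(b_i),\qquad wt_{q,0}(b)=\begin{cases}q^{b-1}&b>0,\\1&b=0.\end{cases}\] Then \[\sum_{B\in\Delta(k,c)\cap\mathbb Z^k} q^{b_1+2b_2+\cdots+(k-1)b_{k-1}}\,wt_{q,0}(B)=q^{k(c-1)}[k]_q.\]
   Context: $[k]_q=1+q+\dots+q^{k-1}$. -}

module Defs where

open import Data.Nat as ℕ using (ℕ; zero; suc)
open import Data.Integer using (ℤ; _+_; _*_; _-_; _^_; 1ℤ; 0ℤ; +_)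
open import Data.List using (List; []; _∷_; map; concatMap; upTo; foldr)
open import Data.Vec using (Vec; []; _∷_)

-- Δ(k,c) ∩ ℤ^k : all vectors (b₀,…,b_{k-1}) of naturals summing to c,
-- enumerated (each exactly once) as a list.
Δ : (k c : ℕ) → List (Vec ℕ k)
Δ zero zero = [] ∷ []
Δ zero (suc c) = []
Δ (suc k) c = concatMap (λ b → map (b ∷_) (Δ k (c ℕ.∸ b))) (upTo (suc c))

numPos : ∀ {k} → Vec ℕ k → ℕ
numPos [] = 0
numPos (zero ∷ v) = numPos v
numPos (suc _ ∷ v) = suc (numPos v)

wt0 : ℤ → ℕ → ℤ
wt0 q zero = 1ℤ
wt0 q (suc b) = q ^ b

prodWt0 : ∀ {k} → ℤ → Vec ℕ k → ℤ
prodWt0 q [] = 1ℤ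
prodWt0 q (b ∷ v) = wt0 q b * prodWt0 q v

-- wt_{q,0}(B) = (q-1)^{#{i : b_i>0} - 1} ∏ wt_{q,0}(b_i)
-- (used only for c ≥ 1, where #{i : b_i>0} ≥ 1, so truncated ∸ is exact)
wtB : ∀ {k} → ℤ → Vec ℕ k → ℤ
wtB q B = (q - 1ℤ) ^ (numPos B ℕ.∸ 1) * prodWt0 q B

idxSumFrom : ∀ {k} → ℕ → Vec ℕ k → ℕ
idxSumFrom o [] = 0
idxSumFrom o (b ∷ v) = o ℕ.* b ℕ.+ idxSumFrom (suc o) v

idxSum : ∀ {k} → Vec ℕ k → ℕ
idxSum = idxSumFrom 0

sumℤ : List ℤ → ℤ
sumℤ = foldr _+_ 0ℤ

qInt : ℤ → ℕ → ℤ
qInt q k = sumℤ (map (q ^_) (upTo k))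

-- Split a vector of Δ(k, c) at its first entry b.  With the index weights
-- shifted by an offset o, the entry b = 0 just shifts the offset, while
-- b = j + 1 contributes q^(o(j+1)) · q^j = q^o (q^(o+1))^j.  For the
-- companion weight in which every positive entry carries a factor q − 1 the
-- sums over Δ(k, m+1) are q^((o+k)m) (q^(o+k) − q^o): induction on k, the
-- inductive step being a geometric convolution identity.  The theorem's
-- weight carries one factor q − 1 fewer, so once its head is positive it
-- becomes the companion weight of the tail, and the same split finishes.
module Submission where

open import Defs
open import Data.Nat using (ℕ; zero; suc; _≥_; _∸_) renaming (_+_ to _+ℕ_; _*_ to _*ℕ_)
import Data.Nat.Properties as ℕ
open import Data.Integer using (ℤ; _+_; _-_; _*_; _^_; 1ℤ; 0ℤ)
open import Data.Integer.Properties
  using (*-identityˡ; *-zeroʳ; *-assoc; *-distribˡ-+; +-identityˡ; +-identityʳ; +-assoc; +-inverseʳ;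
         ^-distribˡ-+-*; ^-*-assoc)
open import Data.Integer.Solver using (module +-*-Solver)
open import Data.List using (List; []; _∷_; _++_; map; concatMap; upTo; applyUpTo)
open import Data.List.Properties using (map-++; map-∘; map-cong)
open import Data.Vec using (Vec; []; _∷_)
open import Function using (_∘_; id)
open import Relation.Binary.PropositionalEquality
  using (_≡_; refl; sym; trans; cong; cong₂; module ≡-Reasoning)
open +-*-Solver using (solve; _:+_; _:-_; _:*_; _:=_; con)

sumℤ-++ : ∀ xs ys → sumℤ (xs ++ ys) ≡ sumℤ xs + sumℤ ys
sumℤ-++ []       ys = sym (+-identityˡ _)
sumℤ-++ (x ∷ xs) ys = trans (cong (x +_) (sumℤ-++ xs ys)) (sym (+-assoc x _ _))

sumℤ-map-*ˡ : ∀ {A : Set} a (f : A → ℤ) xs → sumℤ (map (λ x → a * f x) xs) ≡ a * sumℤ (map f xs)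
sumℤ-map-*ˡ a f []       = sym (*-zeroʳ a)
sumℤ-map-*ˡ a f (x ∷ xs) =
  trans (cong (a * f x +_) (sumℤ-map-*ˡ a f xs)) (sym (*-distribˡ-+ a (f x) _))

sumℤ-map-cong : ∀ {A : Set} {f g : A → ℤ} xs → (∀ x → f x ≡ g x) → sumℤ (map f xs) ≡ sumℤ (map g xs)
sumℤ-map-cong xs f≗g = cong sumℤ (map-cong f≗g xs)

sumℤ-map-concatMap : ∀ {A B : Set} (f : B → ℤ) (g : A → List B) xs →
  sumℤ (map f (concatMap g xs)) ≡ sumℤ (map (λ x → sumℤ (map f (g x))) xs)
sumℤ-map-concatMap f g []       = refl
sumℤ-map-concatMap f g (x ∷ xs) = begin
  sumℤ (map f (g x ++ concatMap g xs))                  ≡⟨ cong sumℤ (map-++ f (g x) _) ⟩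
  sumℤ (map f (g x) ++ map f (concatMap g xs))          ≡⟨ sumℤ-++ (map f (g x)) _ ⟩
  sumℤ (map f (g x)) + sumℤ (map f (concatMap g xs))
    ≡⟨ cong (sumℤ (map f (g x)) +_) (sumℤ-map-concatMap f g xs) ⟩
  sumℤ (map (λ x → sumℤ (map f (g x))) (x ∷ xs))        ∎
  where open ≡-Reasoning

∑< : ℕ → (ℕ → ℤ) → ℤ
∑< zero    f = 0ℤ
∑< (suc n) f = f 0 + ∑< n (f ∘ suc)

syntax ∑< n (λ i → e) = ∑[ i < n ] e

∑<-cong : ∀ {f g : ℕ → ℤ} n → (∀ i → f i ≡ g i) → ∑< n f ≡ ∑< n g
∑<-cong zero    f≗g = refl
∑<-cong (suc n) f≗g = cong₂ _+_ (f≗g 0) (∑<-cong n (f≗g ∘ suc))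

∑<-*ˡ : ∀ a (f : ℕ → ℤ) n → ∑[ i < n ] (a * f i) ≡ a * ∑< n f
∑<-*ˡ a f zero    = sym (*-zeroʳ a)
∑<-*ˡ a f (suc n) = trans (cong (a * f 0 +_) (∑<-*ˡ a (f ∘ suc) n)) (sym (*-distribˡ-+ a (f 0) _))

sumℤ-map-applyUpTo : ∀ (f : ℕ → ℤ) g n → sumℤ (map f (applyUpTo g n)) ≡ ∑[ i < n ] f (g i)
sumℤ-map-applyUpTo f g zero    = refl
sumℤ-map-applyUpTo f g (suc n) = cong (f (g 0) +_) (sumℤ-map-applyUpTo f (g ∘ suc) n)

∑<-geometric-convolution : ∀ (A R : ℤ) (g : ℕ → ℤ) → g 0 ≡ 1ℤ → (∀ m → g (suc m) ≡ R ^ m * (R - A)) →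
  ∀ m → ∑[ j < suc m ] (A ^ j * g (m ∸ j)) ≡ R ^ m
∑<-geometric-convolution A R g g0 gsuc zero = trans (+-identityʳ _) (trans (*-identityˡ (g 0)) g0)
∑<-geometric-convolution A R g g0 gsuc (suc m) = begin
  1ℤ * g (suc m) + ∑[ j < suc m ] ((A * A ^ j) * g (m ∸ j))
    ≡⟨ cong₂ _+_ (trans (*-identityˡ _) (gsuc m))
                 (trans (∑<-cong (suc m) (λ j → *-assoc A (A ^ j) (g (m ∸ j))))
                        (∑<-*ˡ A (λ j → A ^ j * g (m ∸ j)) (suc m))) ⟩
  R ^ m * (R - A) + A * ∑[ j < suc m ] (A ^ j * g (m ∸ j))
    ≡⟨ cong (λ s → R ^ m * (R - A) + A * s) (∑<-geometric-convolution A R g g0 gsuc m) ⟩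
  R ^ m * (R - A) + A * R ^ m
    ≡⟨ solve 3 (λ x r a → x :* (r :- a) :+ a :* x := r :* x) refl (R ^ m) R A ⟩
  R * R ^ m ∎
  where open ≡-Reasoning

sumℤ-Δ-suc : ∀ k c (f : Vec ℕ (suc k) → ℤ) →
  sumℤ (map f (Δ (suc k) c)) ≡ ∑[ b < suc c ] sumℤ (map (λ B → f (b ∷ B)) (Δ k (c ∸ b)))
sumℤ-Δ-suc k c f = begin
  sumℤ (map f (concatMap (λ b → map (b ∷_) (Δ k (c ∸ b))) (upTo (suc c))))
    ≡⟨ sumℤ-map-concatMap f (λ b → map (b ∷_) (Δ k (c ∸ b))) (upTo (suc c)) ⟩
  sumℤ (map (λ b → sumℤ (map f (map (b ∷_) (Δ k (c ∸ b))))) (upTo (suc c)))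
    ≡⟨ sumℤ-map-applyUpTo (λ b → sumℤ (map f (map (b ∷_) (Δ k (c ∸ b))))) id (suc c) ⟩
  ∑[ b < suc c ] sumℤ (map f (map (b ∷_) (Δ k (c ∸ b))))
    ≡⟨ ∑<-cong (suc c) (λ b → cong sumℤ (sym (map-∘ {g = f} {f = b ∷_} (Δ k (c ∸ b))))) ⟩
  ∑[ b < suc c ] sumℤ (map (λ B → f (b ∷ B)) (Δ k (c ∸ b))) ∎
  where open ≡-Reasoning

qInt-suc : ∀ q k → qInt q (suc k) ≡ 1ℤ + q * qInt q k
qInt-suc q k = trans (sumℤ-map-applyUpTo (q ^_) id (suc k))
  (cong (1ℤ +_) (trans (∑<-*ˡ q (q ^_) k) (cong (q *_) (sym (sumℤ-map-applyUpTo (q ^_) id k)))))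

module _ (q : ℤ) where

  offsetWeight : ℕ → ℤ → ∀ {k} → Vec ℕ k → ℤ
  offsetWeight o e B = q ^ idxSumFrom o B * (e * prodWt0 q B)

  headWeight : ℕ → ℕ → ℤ
  headWeight o j = q ^ o * (q ^ suc o) ^ j

  headWeight-≡ : ∀ o j → q ^ (o *ℕ suc j) * q ^ j ≡ headWeight o j
  headWeight-≡ o j = begin
    q ^ (o *ℕ suc j) * q ^ j       ≡⟨ sym (^-distribˡ-+-* q (o *ℕ suc j) j) ⟩
    q ^ (o *ℕ suc j +ℕ j)          ≡⟨ cong (q ^_) exponent ⟩
    q ^ (o +ℕ suc o *ℕ j)          ≡⟨ ^-distribˡ-+-* q o (suc o *ℕ j) ⟩
    q ^ o * q ^ (suc o *ℕ j)       ≡⟨ cong (q ^ o *_) (sym (^-*-assoc q (suc o) j)) ⟩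
    headWeight o j                 ∎
    where
    open ≡-Reasoning
    exponent : o *ℕ suc j +ℕ j ≡ o +ℕ suc o *ℕ j
    exponent = trans (cong (_+ℕ j) (ℕ.*-suc o j))
      (trans (ℕ.+-assoc o (o *ℕ j) j) (cong (o +ℕ_) (ℕ.+-comm (o *ℕ j) j)))

  offsetWeight-zero∷ : ∀ o e {k} (B : Vec ℕ k) → offsetWeight o e (0 ∷ B) ≡ offsetWeight (suc o) e B
  offsetWeight-zero∷ o e B rewrite ℕ.*-zeroʳ o | *-identityˡ (prodWt0 q B) = refl

  offsetWeight-suc∷ : ∀ o j e {k} (B : Vec ℕ k) →
    offsetWeight o e (suc j ∷ B) ≡ headWeight o j * offsetWeight (suc o) e B
  offsetWeight-suc∷ o j e B = begin
    q ^ (o *ℕ suc j +ℕ I) * (e * (q ^ j * P))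
      ≡⟨ cong (_* (e * (q ^ j * P))) (^-distribˡ-+-* q (o *ℕ suc j) I) ⟩
    q ^ (o *ℕ suc j) * q ^ I * (e * (q ^ j * P))
      ≡⟨ solve 5 (λ a b c d f → a :* b :* (c :* (d :* f)) := (a :* d) :* (b :* (c :* f))) refl
           (q ^ (o *ℕ suc j)) (q ^ I) e (q ^ j) P ⟩
    (q ^ (o *ℕ suc j) * q ^ j) * offsetWeight (suc o) e B
      ≡⟨ cong (_* offsetWeight (suc o) e B) (headWeight-≡ o j) ⟩
    headWeight o j * offsetWeight (suc o) e B ∎
    where
    open ≡-Reasoning
    I = idxSumFrom (suc o) B
    P = prodWt0 q B

  wt⁺ : ℕ → ∀ {k} → Vec ℕ k → ℤ
  wt⁺ o B = offsetWeight o ((q - 1ℤ) ^ numPos B) B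

  Σwt⁺ : ℕ → ℕ → ℕ → ℤ
  Σwt⁺ o k c = sumℤ (map (wt⁺ o) (Δ k c))

  wtBₒ : ℕ → ∀ {k} → Vec ℕ k → ℤ
  wtBₒ o B = offsetWeight o ((q - 1ℤ) ^ (numPos B ∸ 1)) B

  ΣwtB : ℕ → ℕ → ℕ → ℤ
  ΣwtB o k c = sumℤ (map (wtBₒ o) (Δ k c))

  Σwt⁺-zero : ∀ o k → Σwt⁺ o k 0 ≡ 1ℤ
  Σwt⁺-zero o zero    = refl
  Σwt⁺-zero o (suc k) = begin
    Σwt⁺ o (suc k) 0
      ≡⟨ sumℤ-Δ-suc k 0 (wt⁺ o) ⟩
    sumℤ (map (λ B → wt⁺ o (0 ∷ B)) (Δ k 0)) + 0ℤ
      ≡⟨ +-identityʳ _ ⟩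
    sumℤ (map (λ B → wt⁺ o (0 ∷ B)) (Δ k 0))
      ≡⟨ sumℤ-map-cong (Δ k 0) (λ B → offsetWeight-zero∷ o ((q - 1ℤ) ^ numPos B) B) ⟩
    Σwt⁺ (suc o) k 0
      ≡⟨ Σwt⁺-zero (suc o) k ⟩
    1ℤ ∎
    where open ≡-Reasoning

  Σwt⁺-split : ∀ o k m → Σwt⁺ o (suc k) (suc m) ≡
    Σwt⁺ (suc o) k (suc m) + (q - 1ℤ) * ∑[ j < suc m ] (headWeight o j * Σwt⁺ (suc o) k (m ∸ j))
  Σwt⁺-split o k m = begin
    Σwt⁺ o (suc k) (suc m)
      ≡⟨ sumℤ-Δ-suc k (suc m) (wt⁺ o) ⟩
    sumℤ (map (λ B → wt⁺ o (0 ∷ B)) (Δ k (suc m)))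
      + ∑[ j < suc m ] sumℤ (map (λ B → wt⁺ o (suc j ∷ B)) (Δ k (m ∸ j)))
      ≡⟨ cong₂ _+_ (sumℤ-map-cong (Δ k (suc m)) (λ B → offsetWeight-zero∷ o ((q - 1ℤ) ^ numPos B) B))
                   (∑<-cong (suc m) tail) ⟩
    Σwt⁺ (suc o) k (suc m) + ∑[ j < suc m ] ((q - 1ℤ) * (headWeight o j * Σwt⁺ (suc o) k (m ∸ j)))
      ≡⟨ cong (Σwt⁺ (suc o) k (suc m) +_)
              (∑<-*ˡ (q - 1ℤ) (λ j → headWeight o j * Σwt⁺ (suc o) k (m ∸ j)) (suc m)) ⟩
    Σwt⁺ (suc o) k (suc m) + (q - 1ℤ) * ∑[ j < suc m ] (headWeight o j * Σwt⁺ (suc o) k (m ∸ j)) ∎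
    where
    open ≡-Reasoning
    pull : ∀ j {k} (B : Vec ℕ k) → wt⁺ o (suc j ∷ B) ≡ (q - 1ℤ) * (headWeight o j * wt⁺ (suc o) B)
    pull j B = begin
      offsetWeight o ((q - 1ℤ) * e) (suc j ∷ B)        ≡⟨ offsetWeight-suc∷ o j ((q - 1ℤ) * e) B ⟩
      headWeight o j * offsetWeight (suc o) ((q - 1ℤ) * e) B
        ≡⟨ solve 5 (λ h x a y p → h :* (x :* ((a :* y) :* p)) := a :* (h :* (x :* (y :* p)))) refl
             (headWeight o j) (q ^ idxSumFrom (suc o) B) (q - 1ℤ) e (prodWt0 q B) ⟩
      (q - 1ℤ) * (headWeight o j * wt⁺ (suc o) B) ∎
      where e = (q - 1ℤ) ^ numPos B
    tail : ∀ j → sumℤ (map (λ B → wt⁺ o (suc j ∷ B)) (Δ k (m ∸ j)))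
               ≡ (q - 1ℤ) * (headWeight o j * Σwt⁺ (suc o) k (m ∸ j))
    tail j = trans (sumℤ-map-cong (Δ k (m ∸ j)) (pull j))
      (trans (sumℤ-map-*ˡ (q - 1ℤ) (λ B → headWeight o j * wt⁺ (suc o) B) (Δ k (m ∸ j)))
        (cong ((q - 1ℤ) *_) (sumℤ-map-*ˡ (headWeight o j) (wt⁺ (suc o)) (Δ k (m ∸ j)))))

  ΣwtB-split : ∀ o k m → ΣwtB o (suc k) (suc m) ≡
    ΣwtB (suc o) k (suc m) + ∑[ j < suc m ] (headWeight o j * Σwt⁺ (suc o) k (m ∸ j))
  ΣwtB-split o k m = begin
    ΣwtB o (suc k) (suc m)
      ≡⟨ sumℤ-Δ-suc k (suc m) (wtBₒ o) ⟩
    sumℤ (map (λ B → wtBₒ o (0 ∷ B)) (Δ k (suc m)))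
      + ∑[ j < suc m ] sumℤ (map (λ B → wtBₒ o (suc j ∷ B)) (Δ k (m ∸ j)))
      ≡⟨ cong₂ _+_ (sumℤ-map-cong (Δ k (suc m)) (λ B → offsetWeight-zero∷ o ((q - 1ℤ) ^ (numPos B ∸ 1)) B))
                   (∑<-cong (suc m) tail) ⟩
    ΣwtB (suc o) k (suc m) + ∑[ j < suc m ] (headWeight o j * Σwt⁺ (suc o) k (m ∸ j)) ∎
    where
    open ≡-Reasoning
    tail : ∀ j → sumℤ (map (λ B → wtBₒ o (suc j ∷ B)) (Δ k (m ∸ j)))
               ≡ headWeight o j * Σwt⁺ (suc o) k (m ∸ j)
    tail j = trans (sumℤ-map-cong (Δ k (m ∸ j)) (λ B → offsetWeight-suc∷ o j ((q - 1ℤ) ^ numPos B) B))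
      (sumℤ-map-*ˡ (headWeight o j) (wt⁺ (suc o)) (Δ k (m ∸ j)))

  headConvolution : ∀ o k →
    (∀ m → Σwt⁺ (suc o) k (suc m) ≡ (q ^ (suc o +ℕ k)) ^ m * (q ^ (suc o +ℕ k) - q ^ suc o)) →
    ∀ m → ∑[ j < suc m ] (headWeight o j * Σwt⁺ (suc o) k (m ∸ j)) ≡ q ^ o * (q ^ (suc o +ℕ k)) ^ m
  headConvolution o k Σwt⁺-suc m = begin
    ∑[ j < suc m ] (headWeight o j * Σwt⁺ (suc o) k (m ∸ j))
      ≡⟨ ∑<-cong (suc m) (λ j → *-assoc (q ^ o) ((q ^ suc o) ^ j) (Σwt⁺ (suc o) k (m ∸ j))) ⟩
    ∑[ j < suc m ] (q ^ o * ((q ^ suc o) ^ j * Σwt⁺ (suc o) k (m ∸ j)))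
      ≡⟨ ∑<-*ˡ (q ^ o) (λ j → (q ^ suc o) ^ j * Σwt⁺ (suc o) k (m ∸ j)) (suc m) ⟩
    q ^ o * ∑[ j < suc m ] ((q ^ suc o) ^ j * Σwt⁺ (suc o) k (m ∸ j))
      ≡⟨ cong (q ^ o *_) (∑<-geometric-convolution (q ^ suc o) (q ^ (suc o +ℕ k)) (Σwt⁺ (suc o) k)
                            (Σwt⁺-zero (suc o) k) Σwt⁺-suc m) ⟩
    q ^ o * (q ^ (suc o +ℕ k)) ^ m ∎
    where open ≡-Reasoning

  Σwt⁺-suc : ∀ o k m → Σwt⁺ o k (suc m) ≡ (q ^ (o +ℕ k)) ^ m * (q ^ (o +ℕ k) - q ^ o)
  Σwt⁺-suc o zero m rewrite ℕ.+-identityʳ o | +-inverseʳ (q ^ o) = sym (*-zeroʳ ((q ^ o) ^ m))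
  Σwt⁺-suc o (suc k) m = begin
    Σwt⁺ o (suc k) (suc m)
      ≡⟨ Σwt⁺-split o k m ⟩
    Σwt⁺ (suc o) k (suc m) + (q - 1ℤ) * ∑[ j < suc m ] (headWeight o j * Σwt⁺ (suc o) k (m ∸ j))
      ≡⟨ cong₂ _+_ (Σwt⁺-suc (suc o) k m)
                   (cong ((q - 1ℤ) *_) (headConvolution o k (Σwt⁺-suc (suc o) k) m)) ⟩
    X ^ m * (X - q * q ^ o) + (q - 1ℤ) * (q ^ o * X ^ m)
      ≡⟨ solve 4 (λ y x Q z → y :* (x :- z :* Q) :+ (z :- con 1ℤ) :* (Q :* y) := y :* (x :- Q)) refl
           (X ^ m) X (q ^ o) q ⟩
    X ^ m * (X - q ^ o)
      ≡⟨ cong (λ e → (q ^ e) ^ m * (q ^ e - q ^ o)) (sym (ℕ.+-suc o k)) ⟩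
    (q ^ (o +ℕ suc k)) ^ m * (q ^ (o +ℕ suc k) - q ^ o) ∎
    where
    open ≡-Reasoning
    X = q ^ (suc o +ℕ k)

  ΣwtB-suc : ∀ o k m → ΣwtB o k (suc m) ≡ (q ^ (o +ℕ k)) ^ m * (q ^ o * qInt q k)
  ΣwtB-suc o zero m =
    sym (trans (cong ((q ^ (o +ℕ 0)) ^ m *_) (*-zeroʳ (q ^ o))) (*-zeroʳ ((q ^ (o +ℕ 0)) ^ m)))
  ΣwtB-suc o (suc k) m = begin
    ΣwtB o (suc k) (suc m)
      ≡⟨ ΣwtB-split o k m ⟩
    ΣwtB (suc o) k (suc m) + ∑[ j < suc m ] (headWeight o j * Σwt⁺ (suc o) k (m ∸ j))
      ≡⟨ cong₂ _+_ (ΣwtB-suc (suc o) k m) (headConvolution o k (Σwt⁺-suc (suc o) k) m) ⟩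
    X ^ m * (q * q ^ o * qInt q k) + q ^ o * X ^ m
      ≡⟨ solve 4 (λ y Q z I → y :* (z :* Q :* I) :+ Q :* y := y :* (Q :* (con 1ℤ :+ z :* I))) refl
           (X ^ m) (q ^ o) q (qInt q k) ⟩
    X ^ m * (q ^ o * (1ℤ + q * qInt q k))
      ≡⟨ cong₂ (λ e r → (q ^ e) ^ m * (q ^ o * r)) (sym (ℕ.+-suc o k)) (sym (qInt-suc q k)) ⟩
    (q ^ (o +ℕ suc k)) ^ m * (q ^ o * qInt q (suc k)) ∎
    where
    open ≡-Reasoning
    X = q ^ (suc o +ℕ k)

lemma4p3 : (q : ℤ) (k c : ℕ) → c ≥ 1 → k ≥ 1 →
    sumℤ (map (λ B → q ^ idxSum B * wtB q B) (Δ k c)) ≡ q ^ (k *ℕ (c ∸ 1)) * qInt q k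
lemma4p3 q k (suc m) _ _ = begin
  ΣwtB q 0 k (suc m)               ≡⟨ ΣwtB-suc q 0 k m ⟩
  (q ^ k) ^ m * (1ℤ * qInt q k)    ≡⟨ cong₂ _*_ (^-*-assoc q k m) (*-identityˡ (qInt q k)) ⟩
  q ^ (k *ℕ m) * qInt q k          ∎
  where open ≡-Reasoning
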